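{- Let $g_1,\dots,g_n$ be non-constant Boolean functions with $\mathrm{Rank}(g_i)=r_i$, and let $f:\{0,1\}^n\to\{0,1\}$ be non-constant. Then $$\mathrm{Rank}(f\circ(g_1,\dots,g_n))\ge \mathrm{Depth}_w(f,[r_1-1,\dots,r_n-1])+1\ge \mathrm{Depth}_w(f,[r_1,\dots,r_n])-(n-1).$$
   Context: Decision trees query single variables at internal nodes and have $0/1$-labelled leaves. The rank of a rooted binary tree: leaves have rank $0$; an internal node with children of ranks $a,b$ has rank $a+1$ if $a=b$, else $\max\{a,b\}$; $\mathrm{Rank}(h)$ is the minimum rank of a decision tree computing $h$. For weights $w_1,\dots,w_n$, the weighted depth of a tree $T$ is the maximum over root-to-leaf paths of the sum of weights of the variables queried on that path; $\mathrm{Depth}_w(f,[w_1,\dots,w_n])$ is the minimum weighted depth of a decision tree computing $f$. For $g_i$ of arity $m_i$, $f\circ(g_1,\dots,g_n)(a^1,\dots,a^n)=f(g_1(a^1),\dots,g_n(a^n))$. -}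

module Defs where

open import Data.Nat using (ℕ; zero; suc; _+_; _⊔_; _≤_; _≟_)
open import Data.Bool using (Bool; if_then_else_)
open import Data.Fin using (Fin)
open import Data.Product using (Σ; ∃; _×_; _,_)
open import Relation.Nullary using (¬_; yes; no)
open import Relation.Binary.PropositionalEquality using (_≡_)

BoolFn : Set → Set
BoolFn V = (V → Bool) → Bool

data DT (V : Set) : Set where
  leaf : Bool → DT V
  node : V → DT V → DT V → DT V

eval : {V : Set} → DT V → (V → Bool) → Bool
eval (leaf b)      a = b
eval (node x t₀ t₁) a = if a x then eval t₁ a else eval t₀ a

Computes : {V : Set} → DT V → BoolFn V → Set
Computes T h = ∀ a → eval T a ≡ h a

rankCombine : ℕ → ℕ → ℕ
rankCombine a b with a ≟ b
... | yes _ = suc a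
... | no  _ = a ⊔ b

rank : {V : Set} → DT V → ℕ
rank (leaf _)       = 0
rank (node _ t₀ t₁) = rankCombine (rank t₀) (rank t₁)

wdepth : {V : Set} → (V → ℕ) → DT V → ℕ
wdepth w (leaf _)       = 0
wdepth w (node x t₀ t₁) = w x + (wdepth w t₀ ⊔ wdepth w t₁)

IsRank : {V : Set} → BoolFn V → ℕ → Set
IsRank {V} h r = (Σ (DT V) λ T → Computes T h × rank T ≡ r)
               × (∀ (T : DT V) → Computes T h → r ≤ rank T)

IsDepthW : {V : Set} → BoolFn V → (V → ℕ) → ℕ → Set
IsDepthW {V} h w d = (Σ (DT V) λ T → Computes T h × wdepth w T ≡ d)
                   × (∀ (T : DT V) → Computes T h → d ≤ wdepth w T)

NonConstant : {V : Set} → BoolFn V → Set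
NonConstant h = ∃ λ a → ∃ λ b → ¬ (h a ≡ h b)

BlockVar : (n : ℕ) → (Fin n → ℕ) → Set
BlockVar n m = Σ (Fin n) λ i → Fin (m i)

compose : (n : ℕ) (m : Fin n → ℕ) → BoolFn (Fin n) → ((i : Fin n) → BoolFn (Fin (m i)))
        → BoolFn (BlockVar n m)
compose n m f g a = f (λ i → g i (λ j → a (i , j)))

-- An adversary answers the queries of a tree for f ∘ (g₁,…,gₙ). It keeps a restriction of each block's
-- inputs and a set Q of still possible inputs of f on which f is non-constant and needs weighted depth
-- at least d. Every block is either free, with g i still needing rank above the current weight of
-- variable i on its restriction, or its value is fixed on Q. A query to a free block of weight 0 is
-- answered by fixing g i to a value that keeps f as hard, at no cost in weighted depth. In a block of
-- positive weight the answer keeps the rank of g i whenever possible; otherwise both answers lower it,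
-- the weight of i and the bound d both drop by one in each subtree, and the rank of the node goes up.
-- Starting from weights rᵢ - 1 this gives Rank(f ∘ g) > D₁. For the second inequality, removing the
-- repeated queries to each variable along the paths of an optimal tree for the weights rᵢ - 1 costs at
-- most one extra unit of weight per variable, so D₂ ≤ D₁ + n.

module Submission where

open import Defs
open import Data.Bool using (Bool; true; false; not; if_then_else_) renaming (_≟_ to _≟ᵇ_)
open import Data.Bool.Properties using (¬-not; not-injective)
open import Data.Fin using (Fin) renaming (_≟_ to _≟ᶠ_)
open import Data.List using (List; []; _∷_; length; allFin)
open import Data.List.Properties using (length-tabulate)
open import Data.List.Membership.Propositional using (_∈_)
open import Data.List.Membership.Propositional.Properties using (∈-allFin)
open import Data.List.Relation.Unary.Any using (here; there)
open import Data.Nat using (ℕ; zero; suc; _+_; _∸_; _≤_; _<_; _⊔_; z≤n; s≤s; s≤s⁻¹; _≤?_)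
open import Data.Nat.Properties
open import Data.Product using (Σ-syntax; _×_; _,_; proj₁; proj₂)
open import Data.Sum using (_⊎_; inj₁; inj₂)
open import Data.Unit using (tt)
open import Effect.Monad using (RawMonad)
open import Function using (_∘_; id)
open import Level using (0ℓ)
open import Relation.Binary.Definitions using (DecidableEquality)
open import Relation.Binary.PropositionalEquality
open import Relation.Nullary using (¬_; Dec; yes; no)
open import Relation.Nullary.Decidable using (decidable-stable; ¬¬-excluded-middle)
open import Relation.Nullary.Negation using (DoubleNegation; ¬¬-Monad; contradiction)
open import Relation.Unary using (Pred; U; _⊆_; _∩_)

-- Lower bounds quantify over all trees and are undecidable, so case analyses on them run in the
-- double-negation monad; this suffices because the final inequalities are decidable.
open RawMonad (¬¬-Monad {0ℓ})

private variable
  V : Set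
  P P' : Pred (V → Bool) 0ℓ
  h : BoolFn V
  t t₀ t₁ : DT V
  w : V → ℕ
  k d : ℕ
  v : Bool

suc-≤-rankCombine : ∀ {a b} → k ≤ a → k ≤ b → suc k ≤ rankCombine a b
suc-≤-rankCombine {a = a} {b} k≤a k≤b with a ≟ b
... | yes refl = s≤s k≤a
... | no a≢b with ≤-total a b
...   | inj₁ a≤b = ≤-trans (s≤s k≤a) (≤-trans (≤∧≢⇒< a≤b a≢b) (m≤n⊔m a b))
...   | inj₂ b≤a = ≤-trans (s≤s k≤b) (≤-trans (≤∧≢⇒< b≤a (a≢b ∘ sym)) (m≤m⊔n a b))

≤-rankCombineˡ : ∀ a b → a ≤ rankCombine a b
≤-rankCombineˡ a b with a ≟ b
... | yes refl = n≤1+n a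
... | no _ = m≤m⊔n a b

≤-rankCombineʳ : ∀ a b → b ≤ rankCombine a b
≤-rankCombineʳ a b with a ≟ b
... | yes refl = n≤1+n a
... | no _ = m≤n⊔m a b

rankCombine-≤ : ∀ {a b} → a ≤ k → b ≤ k → a < k ⊎ b < k → rankCombine a b ≤ k
rankCombine-≤ {a = a} {b} a≤k b≤k a<k⊎b<k with a ≟ b | a<k⊎b<k
... | yes refl | inj₁ a<k = a<k
... | yes refl | inj₂ b<k = b<k
... | no _     | _        = ⊔-lub a≤k b≤k

¬∀≤⟶¬¬∃< : {A : Set} {C : A → Set} (μ : A → ℕ) →
           ¬ (∀ x → C x → k ≤ μ x) → DoubleNegation (Σ[ x ∈ A ] C x × μ x < k)
¬∀≤⟶¬¬∃< {k = k} μ ¬bound ¬witness =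
  ¬bound λ x Cx → decidable-stable (k ≤? μ x) (λ k≰μx → ¬witness (x , Cx , ≰⇒> k≰μx))

_≔_ : V → Bool → Pred (V → Bool) 0ℓ
(x ≔ b) a = a x ≡ b

ComputesOn : Pred (V → Bool) 0ℓ → DT V → BoolFn V → Set
ComputesOn P T h = ∀ a → P a → eval T a ≡ h a

RankAtLeast : Pred (V → Bool) 0ℓ → BoolFn V → ℕ → Set
RankAtLeast P h k = ∀ T → ComputesOn P T h → k ≤ rank T

WDepthAtLeast : (V → ℕ) → Pred (V → Bool) 0ℓ → BoolFn V → ℕ → Set
WDepthAtLeast w P h d = ∀ T → ComputesOn P T h → d ≤ wdepth w T

NonConstantOn : Pred (V → Bool) 0ℓ → BoolFn V → Set
NonConstantOn P h = Σ[ a ∈ _ ] Σ[ a' ∈ _ ] P a × P a' × h a ≢ h a'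

Realizable : Pred (V → Bool) 0ℓ → BoolFn V → Bool → Set
Realizable P h v = Σ[ a ∈ _ ] P a × h a ≡ v

Realizable-⊆ : P ⊆ P' → Realizable P h v → Realizable P' h v
Realizable-⊆ P⊆P' (a , Pa , ha≡v) = a , P⊆P' Pa , ha≡v

eval-cong : ∀ (T : DT V) {a a'} → (∀ x → a x ≡ a' x) → eval T a ≡ eval T a'
eval-cong (leaf _) _ = refl
eval-cong (node x t₀ t₁) {a' = a'} a≗a' rewrite a≗a' x with a' x
... | true = eval-cong t₁ a≗a'
... | false = eval-cong t₀ a≗a'

computes⇒cong : ∀ {T : DT V} → Computes T h → ∀ {a a'} → (∀ x → a x ≡ a' x) → h a ≡ h a'
computes⇒cong {h = h} {T = T} T≈h {a} {a'} a≗a' = begin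
  h a         ≡⟨ sym (T≈h a) ⟩
  eval T a    ≡⟨ eval-cong T a≗a' ⟩
  eval T a'   ≡⟨ T≈h a' ⟩
  h a'        ∎
  where open ≡-Reasoning

branch : Bool → DT V → DT V → DT V
branch b t₀ t₁ = if b then t₁ else t₀

eval-node : ∀ {x : V} t₀ t₁ a → eval (node x t₀ t₁) a ≡ eval (branch (a x) t₀ t₁) a
eval-node {x = x} _ _ a with a x
... | true = refl
... | false = refl

rank-branch : ∀ {x : V} b t₀ t₁ → rank (branch b t₀ t₁) ≤ rank (node x t₀ t₁)
rank-branch true t₀ t₁ = ≤-rankCombineʳ (rank t₀) (rank t₁)
rank-branch false t₀ t₁ = ≤-rankCombineˡ (rank t₀) (rank t₁)

wdepth-branch : ∀ b (t₀ t₁ : DT V) → wdepth w (branch b t₀ t₁) ≤ wdepth w t₀ ⊔ wdepth w t₁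
wdepth-branch {w = w} true t₀ t₁ = m≤n⊔m (wdepth w t₀) (wdepth w t₁)
wdepth-branch {w = w} false t₀ t₁ = m≤m⊔n (wdepth w t₀) (wdepth w t₁)

wdepth-mono : ∀ {w w'} (T : DT V) → (∀ x → w x ≤ w' x) → wdepth w T ≤ wdepth w' T
wdepth-mono (leaf _) _ = z≤n
wdepth-mono (node x t₀ t₁) w≤w' =
  +-mono-≤ (w≤w' x) (⊔-mono-≤ (wdepth-mono t₀ w≤w') (wdepth-mono t₁ w≤w'))

ComputesOn-⊆ : P' ⊆ P → ComputesOn P t h → ComputesOn P' t h
ComputesOn-⊆ P'⊆P t≈h a = t≈h a ∘ P'⊆P

branch-computesOn : ∀ {x : V} b t₀ t₁ → ComputesOn P (node x t₀ t₁) h →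
                    ComputesOn (P ∩ (x ≔ b)) (branch b t₀ t₁) h
branch-computesOn _ t₀ t₁ T≈h a (Pa , refl) = trans (sym (eval-node t₀ t₁ a)) (T≈h a Pa)

node-computesOn : ∀ {x : V} t₀ t₁ →
                  ComputesOn (P ∩ (x ≔ false)) t₀ h → ComputesOn (P ∩ (x ≔ true)) t₁ h →
                  ComputesOn P (node x t₀ t₁) h
node-computesOn {x = x} _ _ t₀≈h t₁≈h a Pa with a x in ax≡
... | true = t₁≈h a (Pa , ax≡)
... | false = t₀≈h a (Pa , ax≡)

RankAtLeast-⊆ : P ⊆ P' → RankAtLeast P h k → RankAtLeast P' h k
RankAtLeast-⊆ P⊆P' bound T = bound T ∘ ComputesOn-⊆ {t = T} P⊆P'

nonConstant⇒1≤rank : ∀ {T : DT V} → Computes T h → NonConstant h → 1 ≤ rank T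
nonConstant⇒1≤rank {T = leaf _} T≈h (a , a' , ha≢ha') = contradiction (trans (sym (T≈h a)) (T≈h a')) ha≢ha'
nonConstant⇒1≤rank {T = node _ t₀ t₁} _ _ = suc-≤-rankCombine {a = rank t₀} {rank t₁} z≤n z≤n

isRank⇒rankAtLeast : ∀ {r} → NonConstant h → IsRank h r → RankAtLeast U h (suc (r ∸ 1))
isRank⇒rankAtLeast {r = r} h-nonConst ((T , T≈h , rankT≡r) , minimal) T' T'≈h =
  subst (_≤ rank T') (sym (m+[n∸m]≡n 1≤r)) (minimal T' (λ a → T'≈h a tt))
  where
    1≤r : 1 ≤ r
    1≤r = subst (1 ≤_) rankT≡r (nonConstant⇒1≤rank {T = T} T≈h h-nonConst)

nonConstant⇒realizable : NonConstant h → ∀ v → Realizable U h v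
nonConstant⇒realizable {h = h} (a , a' , ha≢ha') v with h a ≟ᵇ v
... | yes ha≡v = a , tt , ha≡v
... | no ha≢v = a' , tt , not-injective (trans (sym (¬-not ha≢ha')) (¬-not ha≢v))

rankAtLeast⇒realizable : RankAtLeast P h (suc k) → ∀ v → DoubleNegation (Realizable P h v)
rankAtLeast⇒realizable bound v ¬realizable =
  contradiction (bound (leaf (not v)) leaf≈h) λ ()
  where
    leaf≈h : ComputesOn _ (leaf (not v)) _
    leaf≈h a Pa = sym (¬-not (λ ha≡v → ¬realizable (a , Pa , ha≡v)))

rankAtLeast⇒realizable₂ : RankAtLeast P h (suc k) → DoubleNegation (∀ v → Realizable P h v)
rankAtLeast⇒realizable₂ bound = do
  realizes-true ← rankAtLeast⇒realizable bound true
  realizes-false ← rankAtLeast⇒realizable bound false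
  pure λ { true → realizes-true ; false → realizes-false }

-- A tree of rank below k on one half, joined with the other half's tree, would compute h on P
-- with rank at most k.
rankAtLeast-halves : ∀ {x : V} → RankAtLeast P h (suc k) →
                     ComputesOn (P ∩ (x ≔ false)) t₀ h → rank t₀ ≤ k →
                     ComputesOn (P ∩ (x ≔ true)) t₁ h → rank t₁ ≤ k →
                     ∀ b → RankAtLeast (P ∩ (x ≔ b)) h k
rankAtLeast-halves {t₁ = t₁} {x = x} bound _ _ t₁≈h t₁≤k false t t≈h = ≮⇒≥ λ t<k →
  ≤⇒≯ (rankCombine-≤ (<⇒≤ t<k) t₁≤k (inj₁ t<k)) (bound (node x t t₁) (node-computesOn t t₁ t≈h t₁≈h))
rankAtLeast-halves {t₀ = t₀} {x = x} bound t₀≈h t₀≤k _ _ true t t≈h = ≮⇒≥ λ t<k →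
  ≤⇒≯ (rankCombine-≤ t₀≤k (<⇒≤ t<k) (inj₂ t<k)) (bound (node x t₀ t) (node-computesOn t₀ t t₀≈h t≈h))

rankAtLeast-split : ∀ (x : V) → RankAtLeast P h (suc k) →
                    DoubleNegation ((Σ[ b ∈ Bool ] RankAtLeast (P ∩ (x ≔ b)) h (suc k))
                                    ⊎ (∀ b → RankAtLeast (P ∩ (x ≔ b)) h k))
rankAtLeast-split {P = P} {h} {k} x bound = do
  bound₀? ← ¬¬-excluded-middle
  bound₁? ← ¬¬-excluded-middle
  split bound₀? bound₁?
  where
    split : Dec (RankAtLeast (P ∩ (x ≔ false)) h (suc k)) → Dec (RankAtLeast (P ∩ (x ≔ true)) h (suc k)) →
            DoubleNegation ((Σ[ b ∈ Bool ] RankAtLeast (P ∩ (x ≔ b)) h (suc k))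
                            ⊎ (∀ b → RankAtLeast (P ∩ (x ≔ b)) h k))
    split (yes bound₀) _ = pure (inj₁ (false , bound₀))
    split _ (yes bound₁) = pure (inj₁ (true , bound₁))
    split (no ¬bound₀) (no ¬bound₁) = do
      (t₀ , t₀≈h , t₀<) ← ¬∀≤⟶¬¬∃< rank ¬bound₀
      (t₁ , t₁≈h , t₁<) ← ¬∀≤⟶¬¬∃< rank ¬bound₁
      pure (inj₂ (rankAtLeast-halves {t₀ = t₀} {t₁ = t₁} bound t₀≈h (s≤s⁻¹ t₀<) t₁≈h (s≤s⁻¹ t₁<)))

¬nonConstantOn⇒leaf : ¬ NonConstantOn P h → DoubleNegation (Σ[ c ∈ Bool ] ComputesOn P (leaf c) h)
¬nonConstantOn⇒leaf {P = P} {h} constant = leafFor <$> ¬¬-excluded-middle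
  where
    leafFor : Dec (Σ[ a ∈ _ ] P a) → Σ[ c ∈ Bool ] ComputesOn P (leaf c) h
    leafFor (yes (a₀ , Pa₀)) =
      h a₀ , λ a Pa → decidable-stable (h a₀ ≟ᵇ h a) (λ ha₀≢ha → constant (a₀ , a , Pa₀ , Pa , ha₀≢ha))
    leafFor (no empty) = false , λ a Pa → contradiction (a , Pa) empty

wdepthAtLeast-split : ∀ (x : V) → w x ≡ 0 → WDepthAtLeast w P h (suc d) →
                      DoubleNegation (Σ[ v ∈ Bool ] NonConstantOn (P ∩ (x ≔ v)) h
                                                    × WDepthAtLeast w (P ∩ (x ≔ v)) h (suc d))
wdepthAtLeast-split {w = w} {P} {h} {d} x wx≡0 bound ¬split =
  shallow false λ (t₀ , t₀≈h , t₀≤d) → shallow true λ (t₁ , t₁≈h , t₁≤d) →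
    ≤⇒≯ (≤-trans (≤-reflexive (cong (_+ (wdepth w t₀ ⊔ wdepth w t₁)) wx≡0)) (⊔-lub t₀≤d t₁≤d))
        (bound (node x t₀ t₁) (node-computesOn t₀ t₁ t₀≈h t₁≈h))
  where
    shallow : ∀ v → DoubleNegation (Σ[ t ∈ DT _ ] ComputesOn (P ∩ (x ≔ v)) t h × wdepth w t ≤ d)
    shallow v = ¬¬-excluded-middle >>= λ where
      (yes nonConst) → do
        (t , t≈h , t<) ← ¬∀≤⟶¬¬∃< (wdepth w) (λ bound' → ¬split (v , nonConst , bound'))
        pure (t , t≈h , s≤s⁻¹ t<)
      (no constant) → do
        (c , c≈h) ← ¬nonConstantOn⇒leaf constant
        pure (leaf c , c≈h , z≤n)

module Pruning {V : Set} (_≟_ : DecidableEquality V) where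

  lower : V → (V → ℕ) → V → ℕ
  lower x w y with y ≟ x
  ... | yes _ = w y ∸ 1
  ... | no _ = w y

  lower-self : ∀ x w → lower x w x ≡ w x ∸ 1
  lower-self x w with x ≟ x
  ... | yes _ = refl
  ... | no x≢x = contradiction refl x≢x

  suc-lower-self : ∀ x w → w x ≡ suc k → suc (lower x w x) ≡ w x
  suc-lower-self x w wx≡ rewrite lower-self x w | wx≡ = refl

  lower-other : ∀ {x y} w → y ≢ x → lower x w y ≡ w y
  lower-other {x} {y} w y≢x with y ≟ x
  ... | yes y≡x = contradiction y≡x y≢x
  ... | no _ = refl

  lower-≤ : ∀ x w y → lower x w y ≤ w y
  lower-≤ x w y with y ≟ x
  ... | yes _ = m∸n≤m (w y) 1
  ... | no _ = ≤-refl

  resolve : V → Bool → DT V → DT V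
  resolve x b (leaf c) = leaf c
  resolve x b (node y t₀ t₁) with y ≟ x
  ... | yes _ = branch b (resolve x b t₀) (resolve x b t₁)
  ... | no _ = node y (resolve x b t₀) (resolve x b t₁)

  eval-resolve : ∀ {x b} t {a} → a x ≡ b → eval (resolve x b t) a ≡ eval t a
  eval-resolve (leaf _) _ = refl
  eval-resolve {x} (node y t₀ t₁) {a} refl with y ≟ x
  ... | yes refl with a y in ay≡
  ...   | true = eval-resolve t₁ ay≡
  ...   | false = eval-resolve t₀ ay≡
  eval-resolve {x} (node y t₀ t₁) {a} refl | no _ with a y
  ...   | true = eval-resolve t₁ refl
  ...   | false = eval-resolve t₀ refl

  wdepth-resolve : ∀ {x b w} t → wdepth w (resolve x b t) ≤ wdepth (lower x w) t
  wdepth-resolve (leaf _) = z≤n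
  wdepth-resolve {x} {b} {w} (node y t₀ t₁) with y ≟ x
  ... | yes _ = ≤-trans (wdepth-branch b _ _)
                        (≤-trans (⊔-mono-≤ (wdepth-resolve t₀) (wdepth-resolve t₁)) (m≤n+m _ _))
  ... | no _ = +-monoʳ-≤ (w y) (⊔-mono-≤ (wdepth-resolve t₀) (wdepth-resolve t₁))

  -- Keeps only the first query to x on every path; later queries to x are answered by it.
  prune : V → DT V → DT V
  prune x (leaf c) = leaf c
  prune x (node y t₀ t₁) with y ≟ x
  ... | yes _ = node x (resolve x false t₀) (resolve x true t₁)
  ... | no _ = node y (prune x t₀) (prune x t₁)

  eval-prune : ∀ {x} t a → eval (prune x t) a ≡ eval t a
  eval-prune (leaf _) _ = refl
  eval-prune {x} (node y t₀ t₁) a with y ≟ x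
  ... | yes refl with a y in ay≡
  ...   | true = eval-resolve t₁ ay≡
  ...   | false = eval-resolve t₀ ay≡
  eval-prune {x} (node y t₀ t₁) a | no _ with a y
  ...   | true = eval-prune t₁ a
  ...   | false = eval-prune t₀ a

  wdepth-prune : ∀ {x w} t → wdepth w (prune x t) ≤ suc (wdepth (lower x w) t)
  wdepth-prune (leaf _) = z≤n
  wdepth-prune {x} {w} (node y t₀ t₁) with y ≟ x
  ... | yes refl = +-mono-≤ (m≤n+m∸n (w y) 1) (⊔-mono-≤ (wdepth-resolve t₀) (wdepth-resolve t₁))
  ... | no _ = ≤-trans (+-monoʳ-≤ (w y) (⊔-mono-≤ (wdepth-prune t₀) (wdepth-prune t₁)))
                       (≤-reflexive (+-suc (w y) _))

  WDepthAtLeast-lower : ∀ {x} → WDepthAtLeast w P h (suc d) → WDepthAtLeast (lower x w) P h d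
  WDepthAtLeast-lower {x = x} bound t t≈h =
    s≤s⁻¹ (≤-trans (bound (prune x t) (λ a Pa → trans (eval-prune t a) (t≈h a Pa))) (wdepth-prune t))

  pruneAll : List V → DT V → DT V
  pruneAll [] t = t
  pruneAll (x ∷ xs) t = prune x (pruneAll xs t)

  lowerAll : List V → (V → ℕ) → V → ℕ
  lowerAll [] w = w
  lowerAll (x ∷ xs) w = lowerAll xs (lower x w)

  eval-pruneAll : ∀ xs t a → eval (pruneAll xs t) a ≡ eval t a
  eval-pruneAll [] t a = refl
  eval-pruneAll (x ∷ xs) t a = trans (eval-prune (pruneAll xs t) a) (eval-pruneAll xs t a)

  wdepth-pruneAll : ∀ xs w t → wdepth w (pruneAll xs t) ≤ wdepth (lowerAll xs w) t + length xs
  wdepth-pruneAll [] w t = ≤-reflexive (sym (+-identityʳ _))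
  wdepth-pruneAll (x ∷ xs) w t = begin
    wdepth w (prune x (pruneAll xs t))                  ≤⟨ wdepth-prune (pruneAll xs t) ⟩
    suc (wdepth (lower x w) (pruneAll xs t))            ≤⟨ s≤s (wdepth-pruneAll xs (lower x w) t) ⟩
    suc (wdepth (lowerAll xs (lower x w)) t + length xs) ≡⟨ sym (+-suc _ (length xs)) ⟩
    wdepth (lowerAll xs (lower x w)) t + suc (length xs) ∎
    where open ≤-Reasoning

  lowerAll-≤ : ∀ xs w y → lowerAll xs w y ≤ w y
  lowerAll-≤ [] w y = ≤-refl
  lowerAll-≤ (x ∷ xs) w y = ≤-trans (lowerAll-≤ xs (lower x w) y) (lower-≤ x w y)

  lowerAll-∈ : ∀ xs w {y} → y ∈ xs → lowerAll xs w y ≤ w y ∸ 1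
  lowerAll-∈ (x ∷ xs) w (here refl) = ≤-trans (lowerAll-≤ xs (lower x w) x) (≤-reflexive (lower-self x w))
  lowerAll-∈ (x ∷ xs) w (there y∈xs) = ≤-trans (lowerAll-∈ xs (lower x w) y∈xs) (∸-monoˡ-≤ 1 (lower-≤ x w _))

  wdepth-pruneAll-complete : ∀ xs w t → (∀ y → y ∈ xs) →
                             wdepth w (pruneAll xs t) ≤ wdepth (λ y → w y ∸ 1) t + length xs
  wdepth-pruneAll-complete xs w t complete =
    ≤-trans (wdepth-pruneAll xs w t) (+-monoˡ-≤ (length xs) (wdepth-mono t (λ y → lowerAll-∈ xs w (complete y))))

nonConstant⇒1≤arity : ∀ {n} {f : BoolFn (Fin n)} → (∀ {x y} → (∀ i → x i ≡ y i) → f x ≡ f y) →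
                      NonConstant f → 1 ≤ n
nonConstant⇒1≤arity {zero} f-cong (_ , _ , fx≢fy) = contradiction (f-cong λ ()) fx≢fy
nonConstant⇒1≤arity {suc _} _ _ = s≤s z≤n

module Adversary (n : ℕ) (m : Fin n → ℕ) (f : BoolFn (Fin n)) (g : (i : Fin n) → BoolFn (Fin (m i)))
                 (f-cong : ∀ {x y} → (∀ i → x i ≡ y i) → f x ≡ f y) where

  open Pruning {Fin n} _≟ᶠ_ using (lower; suc-lower-self; lower-other; WDepthAtLeast-lower)

  block : (i : Fin n) → (BlockVar n m → Bool) → Fin (m i) → Bool
  block i a j = a (i , j)

  inner : (BlockVar n m → Bool) → Fin n → Bool
  inner a i = g i (block i a)

  Restriction : Set₁
  Restriction = (i : Fin n) → Pred (Fin (m i) → Bool) 0ℓ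

  Consistent : Restriction → Pred (BlockVar n m → Bool) 0ℓ
  Consistent ρ a = ∀ i → ρ i (block i a)

  refine : Restriction → (i : Fin n) → Fin (m i) → Bool → Restriction
  refine ρ i j b i' with i' ≟ᶠ i
  ... | yes refl = ρ i ∩ (j ≔ b)
  ... | no _ = ρ i'

  consistent-refine : ∀ {ρ i j b} → Consistent (refine ρ i j b) ⊆ Consistent ρ ∩ ((i , j) ≔ b)
  consistent-refine {ρ} {i} {j} {b} consistent = (λ i' → coarsen i' (consistent i')) , at-j (consistent i)
    where
      coarsen : ∀ i' {c} → refine ρ i j b i' c → ρ i' c
      coarsen i' with i' ≟ᶠ i
      ... | yes refl = proj₁
      ... | no _ = id
      at-j : ∀ {c} → refine ρ i j b i c → c j ≡ b
      at-j with i ≟ᶠ i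
      ... | yes refl = proj₂
      ... | no i≢i = contradiction refl i≢i

  data BlockStatus (i : Fin n) (P : Pred (Fin (m i) → Bool) 0ℓ) (Q : Pred (Fin n → Bool) 0ℓ) (w : ℕ) : Set where
    free  : RankAtLeast P (g i) (suc w) → (∀ v → Realizable P (g i) v) → BlockStatus i P Q w
    fixed : ∀ v → Realizable P (g i) v → Q ⊆ (i ≔ v) → BlockStatus i P Q w

  record Invariant (T : DT (BlockVar n m)) (ρ : Restriction) (Q : Pred (Fin n → Bool) 0ℓ)
                   (u : Fin n → ℕ) (d : ℕ) : Set where
    constructor invariant
    field
      computes    : ComputesOn (Consistent ρ) T (compose n m f g)
      status      : ∀ i → BlockStatus i (ρ i) Q (u i)
      nonConstant : NonConstantOn Q f
      depth       : WDepthAtLeast u Q f d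

  private variable
    i : Fin n
    j : Fin (m i)
    c : Bool
    ρ : Restriction
    Q Q' : Pred (Fin n → Bool) 0ℓ
    u : Fin n → ℕ
    T : DT (BlockVar n m)

  BlockStatus-⊆ : ∀ {P P' : Pred (Fin (m i) → Bool) 0ℓ} {w} →
                  P ⊆ P' → Q' ⊆ Q → BlockStatus i P Q w → BlockStatus i P' Q' w
  BlockStatus-⊆ P⊆P' _ (free bound realizers) = free (RankAtLeast-⊆ P⊆P' bound) (Realizable-⊆ P⊆P' ∘ realizers)
  BlockStatus-⊆ P⊆P' Q'⊆Q (fixed v realizes-v Q⊆) = fixed v (Realizable-⊆ P⊆P' realizes-v) (Q⊆ ∘ Q'⊆Q)

  refine-status : ∀ {u' : Fin n → ℕ} {b} → Q' ⊆ Q → (∀ {i'} → i' ≢ i → u' i' ≡ u i') →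
                  (∀ i' → BlockStatus i' (ρ i') Q (u i')) → BlockStatus i (ρ i ∩ (j ≔ b)) Q' (u' i) →
                  ∀ i' → BlockStatus i' (refine ρ i j b i') Q' (u' i')
  refine-status {i = i} Q'⊆Q u'≡u status status-i i' with i' ≟ᶠ i
  ... | yes refl = status-i
  ... | no i'≢i rewrite u'≡u i'≢i = BlockStatus-⊆ id Q'⊆Q (status i')

  refine-computes : ComputesOn (Consistent ρ) (node (i , j) t₀ t₁) (compose n m f g) →
                    ∀ b → ComputesOn (Consistent (refine ρ i j b)) (branch b t₀ t₁) (compose n m f g)
  refine-computes {t₀ = t₀} {t₁ = t₁} computes b =
    ComputesOn-⊆ {t = branch b t₀ t₁} consistent-refine (branch-computesOn b t₀ t₁ computes)

  realizer : ∀ {P w x} → BlockStatus i P Q w → Q x → Realizable P (g i) (x i)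
  realizer (free _ realizers) _ = realizers _
  realizer {i = i} {P = P} (fixed _ realizes-v Q⊆) Qx = subst (Realizable P (g i)) (sym (Q⊆ Qx)) realizes-v

  realize : (∀ i → BlockStatus i (ρ i) Q (u i)) → ∀ {x} → Q x →
            Σ[ a ∈ (BlockVar n m → Bool) ] Consistent ρ a × (∀ i → inner a i ≡ x i)
  realize {ρ = ρ} status {x} Qx =
    (λ p → proj₁ (r (proj₁ p)) (proj₂ p)) , proj₁ ∘ proj₂ ∘ r , proj₂ ∘ proj₂ ∘ r
    where
      r : ∀ i → Realizable (ρ i) (g i) (x i)
      r i = realizer (status i) Qx

  leaf-impossible : ¬ Invariant (leaf c) ρ Q u d
  leaf-impossible {c = c} {Q = Q} (invariant c≈fg status (x , y , Qx , Qy , fx≢fy) _) =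
    fx≢fy (trans (sym (leaf-value Qx)) (leaf-value Qy))
    where
      leaf-value : ∀ {z} → Q z → c ≡ f z
      leaf-value Qz with realize status Qz
      ... | a , consistent , inner≗z = trans (c≈fg a consistent) (f-cong inner≗z)

  Descent : DT (BlockVar n m) → DT (BlockVar n m) → Set₁
  Descent t₀ t₁ = ∀ b {ρ Q u d} → Invariant (branch b t₀ t₁) ρ Q u d →
                  DoubleNegation (suc d ≤ rank (branch b t₀ t₁))

  descend-refined : Descent t₀ t₁ → ∀ b → Invariant (node (i , j) t₀ t₁) ρ Q u d →
                    Q' ⊆ Q → NonConstantOn Q' f → WDepthAtLeast u Q' f d →
                    BlockStatus i (ρ i ∩ (j ≔ b)) Q' (u i) →
                    DoubleNegation (suc d ≤ rank (node (i , j) t₀ t₁))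
  descend-refined {t₀ = t₀} {t₁ = t₁} {i = i} {j = j} {u = u} descend b (invariant computes status _ _)
                  Q'⊆Q nonConstant depth status-i =
    (λ d<rank → ≤-trans d<rank (rank-branch {x = i , j} b t₀ t₁)) <$>
    descend b (invariant (refine-computes computes b) (refine-status {u' = u} Q'⊆Q (λ _ → refl) status status-i)
                         nonConstant depth)

  descend-fixed : Descent t₀ t₁ → Invariant (node (i , j) t₀ t₁) ρ Q u (suc d) →
                  Realizable (ρ i) (g i) v → Q ⊆ (i ≔ v) → DoubleNegation (suc (suc d) ≤ rank (node (i , j) t₀ t₁))
  descend-fixed {j = j} {v = v} descend inv (a , a∈ρ , ga≡v) Q⊆ =
    descend-refined descend (a j) inv id (Invariant.nonConstant inv) (Invariant.depth inv)
                    (fixed v (a , (a∈ρ , refl) , ga≡v) Q⊆)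

  -- A query to a block whose weight is 0 is paid for by fixing the value of g i, which costs nothing in f.
  descend-unweighted : Descent t₀ t₁ → Invariant (node (i , j) t₀ t₁) ρ Q u (suc d) → u i ≡ 0 →
                       (∀ v → Realizable (ρ i) (g i) v) → DoubleNegation (suc (suc d) ≤ rank (node (i , j) t₀ t₁))
  descend-unweighted {i = i} {j = j} descend inv ui≡0 realizers = do
    (v , nonConstant , depth) ← wdepthAtLeast-split i ui≡0 (Invariant.depth inv)
    let (a , a∈ρ , ga≡v) = realizers v
    descend-refined descend (a j) inv proj₁ nonConstant depth (fixed v (a , (a∈ρ , refl) , ga≡v) proj₂)

  -- Either answer costs g i one unit of rank; charging it to the weight of i, both subtrees still
  -- need rank above d, so the node needs rank above d + 1.
  descend-both : Descent t₀ t₁ → Invariant (node (i , j) t₀ t₁) ρ Q u (suc d) → u i ≡ suc k →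
                 (∀ b → RankAtLeast (ρ i ∩ (j ≔ b)) (g i) (u i)) →
                 DoubleNegation (suc (suc d) ≤ rank (node (i , j) t₀ t₁))
  descend-both {t₀ = t₀} {t₁ = t₁} {i = i} {j = j} {ρ = ρ} {u = u} {d = d} descend
               (invariant computes status nonConstant depth) ui≡ bounds = do
    d<rank₀ ← descend-lowered false
    d<rank₁ ← descend-lowered true
    pure (suc-≤-rankCombine d<rank₀ d<rank₁)
    where
      descend-lowered : ∀ b → DoubleNegation (suc d ≤ rank (branch b t₀ t₁))
      descend-lowered b = do
        let bound = subst (RankAtLeast (ρ i ∩ (j ≔ b)) (g i)) (sym (suc-lower-self i u ui≡)) (bounds b)
        realizers ← rankAtLeast⇒realizable₂ bound
        descend b (invariant (refine-computes computes b)
                             (refine-status {u' = lower i u} id (lower-other u) status (free bound realizers))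
                             nonConstant (WDepthAtLeast-lower depth))

  descend-weighted : Descent t₀ t₁ → Invariant (node (i , j) t₀ t₁) ρ Q u (suc d) → u i ≡ suc k →
                     RankAtLeast (ρ i) (g i) (suc (u i)) → DoubleNegation (suc (suc d) ≤ rank (node (i , j) t₀ t₁))
  descend-weighted {j = j} descend inv ui≡ bound = rankAtLeast-split j bound >>= λ where
    (inj₁ (b , bound')) → do
      realizers ← rankAtLeast⇒realizable₂ bound'
      descend-refined descend b inv id (Invariant.nonConstant inv) (Invariant.depth inv) (free bound' realizers)
    (inj₂ bounds) → descend-both descend inv ui≡ bounds

  descend-node : ∀ {w} → Descent t₀ t₁ → Invariant (node (i , j) t₀ t₁) ρ Q u (suc d) → u i ≡ w →
                 BlockStatus i (ρ i) Q (u i) → DoubleNegation (suc (suc d) ≤ rank (node (i , j) t₀ t₁))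
  descend-node descend inv _ (fixed _ realizes-v Q⊆) = descend-fixed descend inv realizes-v Q⊆
  descend-node {w = zero} descend inv ui≡0 (free _ realizers) = descend-unweighted descend inv ui≡0 realizers
  descend-node {w = suc _} descend inv ui≡ (free bound _) = descend-weighted descend inv ui≡ bound

  adversary : ∀ T → Invariant T ρ Q u d → DoubleNegation (suc d ≤ rank T)
  adversary (leaf _) inv = λ _ → leaf-impossible inv
  adversary {d = zero} (node _ t₀ t₁) _ = pure (suc-≤-rankCombine {a = rank t₀} {rank t₁} z≤n z≤n)
  adversary {d = suc _} (node (i , j) t₀ t₁) inv = descend-node descend inv refl (Invariant.status inv i)
    where
      descend : Descent t₀ t₁
      descend false = adversary t₀
      descend true = adversary t₁

  initial : ∀ {r : Fin n → ℕ} {D} → Computes T (compose n m f g) →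
            (∀ i → NonConstant (g i)) → (∀ i → IsRank (g i) (r i)) → NonConstant f →
            (∀ S → Computes S f → D ≤ wdepth (λ i → r i ∸ 1) S) →
            Invariant T (λ _ → U) U (λ i → r i ∸ 1) D
  initial T≈fg g-nonConst g-rank (x , y , fx≢fy) D-minimal = invariant
    (λ a _ → T≈fg a)
    (λ i → free (isRank⇒rankAtLeast (g-nonConst i) (g-rank i)) (nonConstant⇒realizable (g-nonConst i)))
    (x , y , tt , tt , fx≢fy)
    (λ S S≈f → D-minimal S (λ a → S≈f a tt))

theorem6p5 : (n : ℕ) (m : Fin n → ℕ) (f : BoolFn (Fin n)) (g : (i : Fin n) → BoolFn (Fin (m i)))
    → (r : Fin n → ℕ) → (∀ i → NonConstant (g i)) → (∀ i → IsRank (g i) (r i))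
    → NonConstant f
    → (R D₁ D₂ : ℕ) → IsRank (compose n m f g) R
    → IsDepthW f (λ i → r i ∸ 1) D₁ → IsDepthW f r D₂
    → (D₁ + 1 ≤ R) × (D₂ ≤ D₁ + 1 + (n ∸ 1))
theorem6p5 n m f g r g-nonConst g-rank f-nonConst R D₁ D₂ ((T , T≈fg , rankT≡R) , _)
           ((S , S≈f , wdepthS≡D₁) , D₁-minimal) (_ , D₂-minimal) = D₁+1≤R , D₂≤D₁+1+[n-1]
  where
    f-cong : ∀ {x y} → (∀ i → x i ≡ y i) → f x ≡ f y
    f-cong = computes⇒cong {T = S} S≈f

    open Adversary n m f g f-cong using (adversary; initial)
    open Pruning {Fin n} _≟ᶠ_ using (pruneAll; eval-pruneAll; wdepth-pruneAll-complete)
    open ≤-Reasoning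

    D₁+1≤R : D₁ + 1 ≤ R
    D₁+1≤R = subst₂ _≤_ (+-comm 1 D₁) rankT≡R
      (decidable-stable (suc D₁ ≤? rank T) (adversary T (initial T≈fg g-nonConst g-rank f-nonConst D₁-minimal)))

    S' : DT (Fin n)
    S' = pruneAll (allFin n) S

    D₂≤D₁+1+[n-1] : D₂ ≤ D₁ + 1 + (n ∸ 1)
    D₂≤D₁+1+[n-1] = begin
      D₂                                            ≤⟨ D₂-minimal S' (λ a → trans (eval-pruneAll (allFin n) S a) (S≈f a)) ⟩
      wdepth r S'                                   ≤⟨ wdepth-pruneAll-complete (allFin n) r S ∈-allFin ⟩
      wdepth (λ i → r i ∸ 1) S + length (allFin n)  ≡⟨ cong₂ _+_ wdepthS≡D₁ (length-tabulate id) ⟩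
      D₁ + n                                        ≡⟨ cong (D₁ +_) (sym (m+[n∸m]≡n 1≤n)) ⟩
      D₁ + (1 + (n ∸ 1))                            ≡⟨ sym (+-assoc D₁ 1 (n ∸ 1)) ⟩
      D₁ + 1 + (n ∸ 1)                              ∎
      where
        1≤n : 1 ≤ n
        1≤n = nonConstant⇒1≤arity f-cong f-nonConst
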